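{- Let $G$ be a graph, let $V(G)=V_1\cup\dots\cup V_k$ be a partition (parts possibly empty) in which each $V_i$ is a clique or an independent set, and let $\psi(i)=(u^i_1,\dots,u^i_{r_i})$ be permutations of $V_i$ such that for every $i$ and every $j\ne i$ either $N_{V_j}(u^i_1)\supseteq\dots\supseteq N_{V_j}(u^i_{r_i})$ or $N_{V_j}(u^i_1)\subseteq\dots\subseteq N_{V_j}(u^i_{r_i})$. Let $D_1$ and $D_2$ be two realizations of the family $S(V_1,\dots,V_k)$. If $F_{D_1}(V_1,\dots,V_k)$ is acyclic, then $F_{D_2}(V_1,\dots,V_k)$ is acyclic.
   Context: Graphs are finite, simple, undirected. $N_X(x)=\{y\in X:xy\in E(G)\}$. For sets $X,Y$ of vertices, $X\sim Y$ means every vertex of $X$ is adjacent to every vertex of $Y$, and $X\not\sim Y$ means no vertex of $X$ is adjacent to any vertex of $Y$. Write $[k]=\{1,\dots,k\}$. Let $Y^i_1$ be the set of $j\in[k]\setminus\{i\}$ for which $N_{V_j}(u^i_1)\supseteq\dots\supseteq N_{V_j}(u^i_{r_i})$ holds, $Y^i_2=([k]\setminus\{i\})\setminus Y^i_1$, $X^i_r=Y^i_r\setminus\{j:V_i\sim V_j\text{ or }V_i\not\sim V_j\}$ ($r=1,2$), and $S(V_1,\dots,V_k)=(\{X^1_1,X^1_2\},\dots,\{X^k_1,X^k_2\})$. For a digraph $D$ on $[k]$ (no loops needed), $N_{in}(v)=\{u\ne v:(u,v)\in A(D)\}$, $N_{out}(v)=\{w\ne v:(v,w)\in A(D)\}$;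 $D$ is a realization of $S$ if $\{N_{in}(i),N_{out}(i)\}=\{X^i_1,X^i_2\}$ for every $i$. Given a realization $D$, the digraph $F_D(V_1,\dots,V_k)$ has vertex set $V(G)$ and arcs: for all $i\ne j$ with $(i,j)\in A(D)$, $u\in V_i$, $v\in V_j$, the arc $(u,v)$ if $uv\in E(G)$ and $(v,u)$ if $uv\notin E(G)$; and for each $i$ the arcs $(u^i_1,u^i_2),\dots,(u^i_{r_i-1},u^i_{r_i})$ if $N_{out}(i)=X^i_1$ in $D$, and otherwise the arcs $(u^i_{r_i},u^i_{r_i-1}),\dots,(u^i_2,u^i_1)$. A digraph is acyclic if it has no directed cycle. -}

module Defs where

open import Data.Nat using (ℕ)
open import Data.Fin using (Fin)
open import Data.List using (List; _∷_; _++_)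
open import Data.List.Membership.Propositional using (_∈_)
open import Data.List.Relation.Unary.Unique.Propositional using (Unique)
open import Data.List.Relation.Unary.Linked using (Linked)
open import Data.Product using (Σ; ∃; _×_; _,_)
open import Data.Sum using (_⊎_)
open import Relation.Nullary using (¬_)
open import Relation.Binary.PropositionalEquality using (_≡_; _≢_)
open import Relation.Binary.Construct.Closure.Transitive using (TransClosure)

record Graph (n : ℕ) : Set₁ where
  field
    Adj    : Fin n → Fin n → Set
    sym    : ∀ {u v} → Adj u v → Adj v u
    irrefl : ∀ {u} → ¬ Adj u u

Digraph : ℕ → Set₁
Digraph k = Fin k → Fin k → Set

SameSet : ∀ {k} → (Fin k → Set) → (Fin k → Set) → Set
SameSet P Q = ∀ j → (P j → Q j) × (Q j → P j)

Acyclic : ∀ {m} → (Fin m → Fin m → Set) → Set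
Acyclic R = ∀ u → ¬ TransClosure R u u

Consecutive : ∀ {A : Set} → List A → A → A → Set
Consecutive xs a b = ∃ λ pre → ∃ λ suf → xs ≡ pre ++ (a ∷ b ∷ suf)

-- psi i is the list (u^i_1, ..., u^i_{r_i}); V_i is the set of its entries.
IsOrderedPartition : ∀ {n k} → (Fin k → List (Fin n)) → Set
IsOrderedPartition {n} {k} ψ =
  (∀ i → Unique (ψ i)) ×
  (∀ (v : Fin n) → ∃ λ i → v ∈ ψ i) ×
  (∀ (v : Fin n) (i j : Fin k) → v ∈ ψ i → v ∈ ψ j → i ≡ j)

module _ {n k : ℕ} (G : Graph n) (ψ : Fin k → List (Fin n)) where
  open Graph G

  CliqueOrIndependent : Fin k → Set
  CliqueOrIndependent i =
    (∀ u v → u ∈ ψ i → v ∈ ψ i → u ≢ v → Adj u v) ⊎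
    (∀ u v → u ∈ ψ i → v ∈ ψ i → ¬ Adj u v)

  SupChain : Fin k → Fin k → Set
  SupChain i j = Linked (λ a b → ∀ v → v ∈ ψ j → Adj b v → Adj a v) (ψ i)

  SubChain : Fin k → Fin k → Set
  SubChain i j = Linked (λ a b → ∀ v → v ∈ ψ j → Adj a v → Adj b v) (ψ i)

  Complete : Fin k → Fin k → Set
  Complete i j = ∀ u v → u ∈ ψ i → v ∈ ψ j → Adj u v

  Anticomplete : Fin k → Fin k → Set
  Anticomplete i j = ∀ u v → u ∈ ψ i → v ∈ ψ j → ¬ Adj u v

  Y₁ : Fin k → Fin k → Set
  Y₁ i j = j ≢ i × SupChain i j

  Y₂ : Fin k → Fin k → Set
  Y₂ i j = j ≢ i × ¬ SupChain i j

  X₁ : Fin k → Fin k → Set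
  X₁ i j = Y₁ i j × ¬ (Complete i j ⊎ Anticomplete i j)

  X₂ : Fin k → Fin k → Set
  X₂ i j = Y₂ i j × ¬ (Complete i j ⊎ Anticomplete i j)

  Nin : Digraph k → Fin k → Fin k → Set
  Nin D i j = j ≢ i × D j i

  Nout : Digraph k → Fin k → Fin k → Set
  Nout D i j = j ≢ i × D i j

  IsRealization : Digraph k → Set
  IsRealization D = ∀ i →
    (SameSet (Nin D i) (X₁ i) × SameSet (Nout D i) (X₂ i)) ⊎
    (SameSet (Nin D i) (X₂ i) × SameSet (Nout D i) (X₁ i))

  data F (D : Digraph k) : Fin n → Fin n → Set where
    between-edge    : ∀ {i j u v} → i ≢ j → D i j → u ∈ ψ i → v ∈ ψ j →
                      Adj u v → F D u v
    between-nonedge : ∀ {i j u v} → i ≢ j → D i j → u ∈ ψ i → v ∈ ψ j →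
                      ¬ Adj u v → F D v u
    inside-forward  : ∀ {i a b} → SameSet (Nout D i) (X₁ i) →
                      Consecutive (ψ i) a b → F D a b
    inside-backward : ∀ {i a b} → ¬ SameSet (Nout D i) (X₁ i) →
                      Consecutive (ψ i) a b → F D b a

module Submission where

-- Fix, for every part i, whether N_out(i) = X^i_1 holds in D₁
-- and in D₂ (this is the only classical step; since the goal is a negation
-- we may decide these finitely many propositions under a double negation).
-- Let swap(i) record whether the two answers differ.  Because every
-- realization makes N_in(i) and N_out(i) the two disjoint sets X^i_1, X^i_2,
-- an arc i → j of D₂ is an arc of D₁ in the same direction when swap(i) is
-- false and in the opposite direction when it is true; looking at the same
-- arc from j shows swap(i) = swap(j).  Hence, colouring every vertex of G by
-- the swap bit of its part, each arc of F_{D₂} joins two vertices of one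
-- colour b and is an arc of F_{D₁}, reversed when b is true.  A directed
-- cycle of F_{D₂} is then monochromatic and yields a directed cycle of
-- F_{D₁} or of its reverse, both excluded by acyclicity of F_{D₁}.

open import Defs
open import Data.Fin using (Fin)
open import Data.Fin.Properties using (sequence)
open import Data.List using (List)
open import Data.List.Membership.Propositional using (_∈_)
open import Data.List.Membership.Propositional.Properties using (∈-++⁺ʳ)
open import Data.List.Relation.Unary.Any using (here; there)
open import Data.Sum using (_⊎_; inj₁; inj₂)
open import Data.Empty using (⊥)
open import Data.Product using (_×_; _,_; proj₁; proj₂; ∃)
open import Data.Bool using (Bool; true; false; not; _xor_; if_then_else_)
open import Function using (flip; _∘_)
open import Relation.Nullary using (¬_; Dec; yes; no; does; contradiction)
open import Relation.Nullary.Negation using (¬¬-Monad)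
open import Relation.Nullary.Decidable using (¬¬-excluded-middle)
open import Relation.Binary.PropositionalEquality using (_≡_; _≢_; refl; sym; trans; cong)
open import Relation.Binary.Construct.Closure.Transitive using (TransClosure; [_]; _∷_; _∷ʳ_)
open import Effect.Monad using (RawMonad)

Rev : {A : Set} → (A → A → Set) → Bool → A → A → Set
Rev R b x y = if b then R y x else R x y

rev-map : ∀ {A B : Set} {R : A → A → Set} {S : B → B → Set} {x y x′ y′} b →
          (R x y → S x′ y′) → (R y x → S y′ x′) → Rev R b x y → Rev S b x′ y′
rev-map false forwards backwards = forwards
rev-map true  forwards backwards = backwards

rev-not : ∀ {A : Set} {R : A → A → Set} {x y} b → Rev R (not b) x y → Rev R b y x
rev-not false r = r
rev-not true  r = r

rev-agree : ∀ {A : Set} {R : A → A → Set} {x y} b c →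
            (R x y → R y x → ⊥) → Rev R b x y → Rev R c x y → b ≡ c
rev-agree false false antisym r s = refl
rev-agree true  true  antisym r s = refl
rev-agree false true  antisym r s = contradiction s (antisym r)
rev-agree true  false antisym r s = contradiction r (antisym s)

reverse⁺ : ∀ {A : Set} {R : A → A → Set} {x y} →
           TransClosure (flip R) x y → TransClosure R y x
reverse⁺ [ r ]    = [ r ]
reverse⁺ (r ∷ rs) = reverse⁺ rs ∷ʳ r

acyclic-rev : ∀ {m} {R : Fin m → Fin m → Set} →
              Acyclic R → ∀ b → Acyclic (Rev R b)
acyclic-rev acyclic false = acyclic
acyclic-rev acyclic true u cycle = acyclic u (reverse⁺ cycle)

ColouredArc : ∀ {A : Set} → (A → Bool) → (A → A → Set) → A → A → Set
ColouredArc colour R x y = ∃ λ b → colour x ≡ b × colour y ≡ b × Rev R b x y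

coloured-walk : ∀ {A : Set} {R S : A → A → Set} (colour : A → Bool) →
                (∀ {x y} → S x y → ColouredArc colour R x y) →
                ∀ {x y} → TransClosure S x y →
                ∃ λ b → colour x ≡ b × TransClosure (Rev R b) x y
coloured-walk colour arc [ s ] with arc s
... | b , colour-x , _ , r = b , colour-x , [ r ]
coloured-walk colour arc (s ∷ ss) with arc s | coloured-walk colour arc ss
... | b , colour-x , refl , r | _ , refl , rs = b , colour-x , r ∷ rs

acyclic-transfer : ∀ {m} {R S : Fin m → Fin m → Set} (colour : Fin m → Bool) →
                   (∀ {x y} → S x y → ColouredArc colour R x y) →
                   Acyclic R → Acyclic S
acyclic-transfer colour arc acyclic u cycle with coloured-walk colour arc cycle
... | b , _ , walk = acyclic-rev acyclic b u walk

¬¬-decide-all : ∀ {k} (P : Fin k → Set) → ¬ ¬ (∀ i → Dec (P i))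
¬¬-decide-all P = sequence (RawMonad.rawApplicative ¬¬-Monad) (λ i → ¬¬-excluded-middle)

consecutive-∈ : ∀ {A : Set} {xs : List A} {a b : A} →
                Consecutive xs a b → a ∈ xs × b ∈ xs
consecutive-∈ (pre , suf , refl) = ∈-++⁺ʳ pre (here refl) , ∈-++⁺ʳ pre (there (here refl))

sameSet-sym : ∀ {k} {P Q : Fin k → Set} → SameSet P Q → SameSet Q P
sameSet-sym P≅Q j = proj₂ (P≅Q j) , proj₁ (P≅Q j)

sameSet-trans : ∀ {k} {P Q R : Fin k → Set} → SameSet P Q → SameSet Q R → SameSet P R
sameSet-trans P≅Q Q≅R j = proj₁ (Q≅R j) ∘ proj₁ (P≅Q j) , proj₂ (P≅Q j) ∘ proj₂ (Q≅R j)

via : ∀ {k} {P Q X : Fin k → Set} → SameSet P X → SameSet Q X → ∀ {j} → P j → Q j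
via P≅X Q≅X {j} = proj₁ (sameSet-trans P≅X (sameSet-sym Q≅X) j)

module Realizations {n k} (G : Graph n) (ψ : Fin k → List (Fin n)) where
  open Graph G using () renaming (sym to adj-sym)

  Forward : Digraph k → Fin k → Set
  Forward D i = SameSet (Nout G ψ D i) (X₁ G ψ i)

  Canon : Bool → Digraph k → Fin k → Set
  Canon true  D i = SameSet (Nin G ψ D i) (X₂ G ψ i) × SameSet (Nout G ψ D i) (X₁ G ψ i)
  Canon false D i = SameSet (Nin G ψ D i) (X₁ G ψ i) × SameSet (Nout G ψ D i) (X₂ G ψ i)

  -- A realization satisfies the alternative singled out by the Forward
  -- test (even when X^i_1 and X^i_2 are both empty and both alternatives hold).
  canonical : ∀ {D i} → IsRealization G ψ D → (forward? : Dec (Forward D i)) →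
              Canon (does forward?) D i
  canonical {i = i} realization (yes forward) with realization i
  ... | inj₂ canon = canon
  ... | inj₁ (in≅X₁ , out≅X₂) =
    sameSet-trans in≅X₁ (sameSet-trans (sameSet-sym forward) out≅X₂) , forward
  canonical {i = i} realization (no backward) with realization i
  ... | inj₁ canon = canon
  ... | inj₂ (_ , out≅X₁) = contradiction out≅X₁ backward

  X-disjoint : ∀ i j → X₁ G ψ i j → X₂ G ψ i j → ⊥
  X-disjoint i j ((_ , sup) , _) ((_ , ¬sup) , _) = ¬sup sup

  canon-antisym : ∀ {b D i j} → Canon b D i → j ≢ i → D i j → D j i → ⊥
  canon-antisym {true}  {i = i} {j} (in≅X₂ , out≅X₁) j≢i ij ji =
    X-disjoint i j (proj₁ (out≅X₁ j) (j≢i , ij)) (proj₁ (in≅X₂ j) (j≢i , ji))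
  canon-antisym {false} {i = i} {j} (in≅X₁ , out≅X₂) j≢i ij ji =
    X-disjoint i j (proj₁ (in≅X₁ j) (j≢i , ji)) (proj₁ (out≅X₂ j) (j≢i , ij))

  transfer : ∀ {b₁ b₂ D₁ D₂ i j} → Canon b₁ D₁ i → Canon b₂ D₂ i → j ≢ i →
             (D₂ i j → Rev D₁ (b₂ xor b₁) i j) × (D₂ j i → Rev D₁ (b₂ xor b₁) j i)
  transfer {true}  {true}  (in₁ , out₁) (in₂ , out₂) j≢i =
    (λ d → proj₂ (via out₂ out₁ (j≢i , d))) , (λ d → proj₂ (via in₂ in₁ (j≢i , d)))
  transfer {false} {false} (in₁ , out₁) (in₂ , out₂) j≢i =
    (λ d → proj₂ (via out₂ out₁ (j≢i , d))) , (λ d → proj₂ (via in₂ in₁ (j≢i , d)))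
  transfer {true}  {false} (in₁ , out₁) (in₂ , out₂) j≢i =
    (λ d → proj₂ (via out₂ in₁ (j≢i , d))) , (λ d → proj₂ (via in₂ out₁ (j≢i , d)))
  transfer {false} {true}  (in₁ , out₁) (in₂ , out₂) j≢i =
    (λ d → proj₂ (via out₂ in₁ (j≢i , d))) , (λ d → proj₂ (via in₂ out₁ (j≢i , d)))

  inside-arc : ∀ {D i a b} (forward? : Dec (Forward D i)) → Consecutive (ψ i) a b →
               Rev (F G ψ D) (not (does forward?)) a b
  inside-arc (yes forward)  c = inside-forward forward c
  inside-arc (no backward) c = inside-backward backward c

  module Comparison
    (covers   : ∀ (v : Fin n) → ∃ λ i → v ∈ ψ i)
    (disjoint : ∀ (v : Fin n) (i j : Fin k) → v ∈ ψ i → v ∈ ψ j → i ≡ j)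
    {D₁ D₂ : Digraph k} (realization₁ : IsRealization G ψ D₁) (realization₂ : IsRealization G ψ D₂)
    (forward₁? : ∀ i → Dec (Forward D₁ i)) (forward₂? : ∀ i → Dec (Forward D₂ i)) where

    swap : Fin k → Bool
    swap i = does (forward₂? i) xor does (forward₁? i)

    canon₁ : ∀ i → Canon (does (forward₁? i)) D₁ i
    canon₁ i = canonical realization₁ (forward₁? i)

    canon₂ : ∀ i → Canon (does (forward₂? i)) D₂ i
    canon₂ i = canonical realization₂ (forward₂? i)

    between : ∀ {i j} → i ≢ j → D₂ i j → swap i ≡ swap j × Rev D₁ (swap i) i j
    between {i} {j} i≢j d = agree , seen-from-i
      where
      j≢i : j ≢ i
      j≢i = i≢j ∘ sym
      seen-from-i : Rev D₁ (swap i) i j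
      seen-from-i = proj₁ (transfer (canon₁ i) (canon₂ i) j≢i) d
      seen-from-j : Rev D₁ (swap j) i j
      seen-from-j = proj₂ (transfer (canon₁ j) (canon₂ j) i≢j) d
      agree : swap i ≡ swap j
      agree = rev-agree {R = D₁} (swap i) (swap j) (canon-antisym (canon₁ i) j≢i) seen-from-i seen-from-j

    inside-forward-swap : ∀ {i a b} → Forward D₂ i → Consecutive (ψ i) a b →
                          Rev (F G ψ D₁) (swap i) a b
    inside-forward-swap {i} forward c with forward₂? i
    ... | yes _        = inside-arc (forward₁? i) c
    ... | no backward  = contradiction forward backward

    inside-backward-swap : ∀ {i a b} → ¬ Forward D₂ i → Consecutive (ψ i) a b →
                           Rev (F G ψ D₁) (swap i) b a
    inside-backward-swap {i} backward c with forward₂? i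
    ... | yes forward = contradiction forward backward
    ... | no _        = rev-not {R = F G ψ D₁} (does (forward₁? i)) (inside-arc (forward₁? i) c)

    colour : Fin n → Bool
    colour v = swap (proj₁ (covers v))

    colour-at : ∀ {v i} → v ∈ ψ i → colour v ≡ swap i
    colour-at {v} {i} v∈Vi = cong swap (disjoint v _ i (proj₂ (covers v)) v∈Vi)

    arc : ∀ {u v} → F G ψ D₂ u v → ColouredArc colour (F G ψ D₁) u v
    arc (between-edge {i} i≢j d u∈Vi v∈Vj uv) with between i≢j d
    ... | agree , oriented =
      swap i , colour-at u∈Vi , trans (colour-at v∈Vj) (sym agree) ,
      rev-map {R = D₁} {S = F G ψ D₁} (swap i)
              (λ d₁ → between-edge i≢j d₁ u∈Vi v∈Vj uv)
              (λ d₁ → between-edge (i≢j ∘ sym) d₁ v∈Vj u∈Vi (adj-sym uv)) oriented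
    arc (between-nonedge {i} i≢j d u∈Vi v∈Vj ¬uv) with between i≢j d
    ... | agree , oriented =
      swap i , trans (colour-at v∈Vj) (sym agree) , colour-at u∈Vi ,
      rev-map {R = D₁} {S = F G ψ D₁} (swap i)
              (λ d₁ → between-nonedge i≢j d₁ u∈Vi v∈Vj ¬uv)
              (λ d₁ → between-nonedge (i≢j ∘ sym) d₁ v∈Vj u∈Vi (¬uv ∘ adj-sym)) oriented
    arc (inside-forward forward c) =
      _ , colour-at (proj₁ (consecutive-∈ c)) , colour-at (proj₂ (consecutive-∈ c)) ,
      inside-forward-swap forward c
    arc (inside-backward backward c) =
      _ , colour-at (proj₂ (consecutive-∈ c)) , colour-at (proj₁ (consecutive-∈ c)) ,
      inside-backward-swap backward c

    acyclic : Acyclic (F G ψ D₁) → Acyclic (F G ψ D₂)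
    acyclic = acyclic-transfer colour arc

open Realizations using (Forward; module Comparison)

proposition4 : ∀ {n k} (G : Graph n) (ψ : Fin k → List (Fin n)) →
    IsOrderedPartition ψ →
    (∀ i → CliqueOrIndependent G ψ i) →
    (∀ i j → j ≢ i → SupChain G ψ i j ⊎ SubChain G ψ i j) →
    (D₁ D₂ : Digraph k) →
    IsRealization G ψ D₁ → IsRealization G ψ D₂ →
    Acyclic (F G ψ D₁) → Acyclic (F G ψ D₂)
proposition4 G ψ (_ , covers , disjoint) _ _ D₁ D₂ realization₁ realization₂ acyclic₁ u cycle =
  ¬¬-decide-all (Forward G ψ D₁) λ forward₁? →
  ¬¬-decide-all (Forward G ψ D₂) λ forward₂? →
  Comparison.acyclic G ψ covers disjoint realization₁ realization₂ forward₁? forward₂? acyclic₁ u cycle
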